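{- Let $G$ be a multigraph on $[n]$ which is the union of the Hamilton cycle $H$ with cyclic order $(1\,2\,\cdots\,n)$ and a perfect matching $M$ on $[n]$, with $p(i)$ the partner of $i$ in $M$. Let $1\le i_0\le i_1\le n-1$, let $c_0$ be a proper $3$-colouring of $G[[i_0]]$, let $S_0\subseteq[i_0]$, and run the procedure \textbf{Sudoku} (described below) from $i_0$ to $i_1$. Let $\mathcal{B}_C$ be the set of vertices $j\in\{i_0+1,\dots,i_1\}$ whose processing falls into case (A2), (B2a) or (B2b), and let $\mathcal{B}_U^{(c)}$, $\mathcal{B}_U^{(d)}$ be the sets of vertices whose processing falls into cases (B2c), (B2d) respectively. Then $$|S(i_1)|\le \tfrac12|\mathcal{B}_C|+|\mathcal{B}_U^{(c)}|+2|\mathcal{B}_U^{(d)}|+|S_0|.$$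
   Context: Procedure \textbf{Sudoku}: set $c=c_0$ on $[i_0]$, $S(i_0)=S_0$, $\mathbf{ptr}(i_0)=i_0$. For $i=i_0,\dots,i_1-1$, vertex $i+1$ is processed as follows. Case $\mathbf{ptr}(i)=i$: (A1) if $p(i+1)<i+1$ and $c(p(i+1))\neq c(i)$: $c(i+1)$ is the unique colour not in $\{c(p(i+1)),c(i)\}$, $S(i+1)=S(i)$, $\mathbf{ptr}(i+1)=i+1$. (A2) otherwise (i.e. $p(i+1)>i+1$, or $p(i+1)<i+1$ and $c(p(i+1))=c(i)$): $c(i+1)$ is chosen arbitrarily from $\{1,2,3\}\setminus\{c(i)\}$, $S(i+1)=S(i)$, $\mathbf{ptr}(i+1)=i$. Case $\mathbf{ptr}(i)<i$: let $C_{i+1}=\{c(i-1),c(i)\}$ if $p(i)>i$ and $C_{i+1}=\{c(i),c(p(i))\}$ if $p(i)<i$. (B1) if $p(i+1)\le\mathbf{ptr}(i)$ and $c(p(i+1))\in C_{i+1}$: $c(i+1)$ is the colour not in $C_{i+1}$, $S(i+1)=S(i)$, $\mathbf{ptr}(i+1)=\mathbf{ptr}(i)$. (B2a) if $p(i+1)>i+1$: $c(i+1)$ is the colour not in $C_{i+1}$, $S(i+1)=S(i)\cup\{i+1\}$, $\mathbf{ptr}(i+1)=i+1$. (B2b) if $p(i+1)\le\mathbf{ptr}(i)$ and $c(p(i+1))\notin C_{i+1}$: $c(i+1)$ is the colour not in $\{c(i),c(p(i+1))\}$, $S(i+1)=S(i)\cup\{i\}$, $\mathbf{ptr}(i+1)=i+1$.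 (B2c) if $\mathbf{ptr}(i)+1\le p(i+1)\le i$ and $c(p(i+1))\in C_{i+1}$: $c(i+1)$ is the colour not in $C_{i+1}$, $S(i+1)=S(i)\cup\{i+1\}$, $\mathbf{ptr}(i+1)=i+1$. (B2d) if $\mathbf{ptr}(i)+1\le p(i+1)\le i$ and $c(p(i+1))\notin C_{i+1}$: $c(i+1)$ is the colour not in $\{c(i),c(p(i+1))\}$, $S(i+1)=S(i)\cup\{i,i+1\}$, $\mathbf{ptr}(i+1)=i+1$. -}

module Defs where

open import Data.Nat using (ℕ; zero; suc; _+_; _*_; _∸_; _≤_; _<_; _≡ᵇ_)
open import Data.Bool using (Bool; true; false; if_then_else_; _∨_; T)
open import Data.Fin using (Fin)
open import Data.Product using (_×_; Σ)
open import Data.Sum using (_⊎_)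
open import Relation.Nullary using (¬_)
open import Relation.Binary.PropositionalEquality using (_≡_; _≢_)
open import Data.Nat using (_<ᵇ_)

-- Vertices are the naturals 1..n; "v ∈ [k]" means 1 ≤ v ≤ k.
InRange : ℕ → ℕ → Set
InRange k v = 1 ≤ v × v ≤ k

Colour : Set
Colour = Fin 3

IsPerfectMatching : ℕ → (ℕ → ℕ) → Set
IsPerfectMatching n p =
  ∀ v → InRange n v → InRange n (p v) × p v ≢ v × p (p v) ≡ v

-- Adjacency in the multigraph G = H ∪ M, H the Hamilton cycle (1 2 ... n).
Adj : ℕ → (ℕ → ℕ) → ℕ → ℕ → Set
Adj n p u v =
  (suc u ≡ v) ⊎ (suc v ≡ u) ⊎ (u ≡ n × v ≡ 1) ⊎ (v ≡ n × u ≡ 1) ⊎ (p u ≡ v)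

ProperOn : ℕ → (ℕ → ℕ) → ℕ → (ℕ → Colour) → Set
ProperOn n p k c0 =
  ∀ u v → InRange k u → InRange k v → Adj n p u v → c0 u ≢ c0 v

-- number of j ∈ {a+1, ..., a+k} with f j = true
countFrom : (ℕ → Bool) → ℕ → ℕ → ℕ
countFrom f a zero = 0
countFrom f a (suc k) = (if f (a + suc k) then 1 else 0) + countFrom f a k

card : ℕ → (ℕ → Bool) → ℕ
card n S = countFrom S 0 n

data Case : Set where
  A1 A2 B1 B2a B2b B2c B2d : Case

isBC : Case → Bool
isBC A2 = true
isBC B2a = true
isBC B2b = true
isBC _ = false

isBUc : Case → Bool
isBUc B2c = true
isBUc _ = false

isBUd : Case → Bool
isBUd B2d = true
isBUd _ = false

NotIn₂ : Colour → Colour → Colour → Set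
NotIn₂ x a b = x ≢ a × x ≢ b

In₂ : Colour → Colour → Colour → Set
In₂ x a b = x ≡ a ⊎ x ≡ b

-- The set C_{i+1} = {Cfst, Csnd}: {c(i-1), c(i)} if p(i) > i, {c(i), c(p(i))} if p(i) < i.
Cfst : (ℕ → ℕ) → (ℕ → Colour) → ℕ → Colour
Cfst p c i = if i <ᵇ p i then c (i ∸ 1) else c i

Csnd : (ℕ → ℕ) → (ℕ → Colour) → ℕ → Colour
Csnd p c i = if i <ᵇ p i then c i else c (p i)

AddOne : (ℕ → Bool) → (ℕ → Bool) → ℕ → Set
AddOne S' S y = ∀ x → S' x ≡ (S x ∨ (x ≡ᵇ y))

AddTwo : (ℕ → Bool) → (ℕ → Bool) → ℕ → ℕ → Set
AddTwo S' S y z = ∀ x → S' x ≡ (S x ∨ (x ≡ᵇ y) ∨ (x ≡ᵇ z))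

SameSet : (ℕ → Bool) → (ℕ → Bool) → Set
SameSet S' S = ∀ x → S' x ≡ S x

-- One step of Sudoku: processing vertex i+1 from the state at i, in the given case.
-- c is the (eventual) colouring: c(j) is fixed when vertex j is processed.
data Step (p : ℕ → ℕ) (c : ℕ → Colour) (S : ℕ → ℕ → Bool) (ptr : ℕ → ℕ) (i : ℕ)
     : Case → Set where
  stepA1 : ptr i ≡ i → p (suc i) < suc i → c (p (suc i)) ≢ c i →
           NotIn₂ (c (suc i)) (c (p (suc i))) (c i) →
           SameSet (S (suc i)) (S i) → ptr (suc i) ≡ suc i →
           Step p c S ptr i A1
  stepA2 : ptr i ≡ i →
           (suc i < p (suc i) ⊎ (p (suc i) < suc i × c (p (suc i)) ≡ c i)) →
           c (suc i) ≢ c i →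
           SameSet (S (suc i)) (S i) → ptr (suc i) ≡ i →
           Step p c S ptr i A2
  stepB1 : ptr i < i → p (suc i) ≤ ptr i →
           In₂ (c (p (suc i))) (Cfst p c i) (Csnd p c i) →
           NotIn₂ (c (suc i)) (Cfst p c i) (Csnd p c i) →
           SameSet (S (suc i)) (S i) → ptr (suc i) ≡ ptr i →
           Step p c S ptr i B1
  stepB2a : ptr i < i → suc i < p (suc i) →
            NotIn₂ (c (suc i)) (Cfst p c i) (Csnd p c i) →
            AddOne (S (suc i)) (S i) (suc i) → ptr (suc i) ≡ suc i →
            Step p c S ptr i B2a
  stepB2b : ptr i < i → p (suc i) ≤ ptr i →
            ¬ In₂ (c (p (suc i))) (Cfst p c i) (Csnd p c i) →
            NotIn₂ (c (suc i)) (c i) (c (p (suc i))) →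
            AddOne (S (suc i)) (S i) i → ptr (suc i) ≡ suc i →
            Step p c S ptr i B2b
  stepB2c : ptr i < i → suc (ptr i) ≤ p (suc i) → p (suc i) ≤ i →
            In₂ (c (p (suc i))) (Cfst p c i) (Csnd p c i) →
            NotIn₂ (c (suc i)) (Cfst p c i) (Csnd p c i) →
            AddOne (S (suc i)) (S i) (suc i) → ptr (suc i) ≡ suc i →
            Step p c S ptr i B2c
  stepB2d : ptr i < i → suc (ptr i) ≤ p (suc i) → p (suc i) ≤ i →
            ¬ In₂ (c (p (suc i))) (Cfst p c i) (Csnd p c i) →
            NotIn₂ (c (suc i)) (c i) (c (p (suc i))) →
            AddTwo (S (suc i)) (S i) i (suc i) → ptr (suc i) ≡ suc i →
            Step p c S ptr i B2d

{-# OPTIONS --safe #-}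
-- The potential Φ(i) = 2|S(i)| + [ptr(i) < i] grows, when vertex i+1 is processed, by at most
-- the weight of its case: 1 for (A2), (B2a), (B2b), 2 for (B2c), 4 for (B2d) and 0 otherwise.
-- Indeed (A2) opens a pending stretch ptr(i) < i without touching S, (B1) keeps it open, and each
-- (B2·) case closes it while adding one vertex to S (two for (B2d)), so Φ changes by 2·1 − 1 or
-- 2·2 − 1. Summing over i₀ ≤ i < i₁ gives the bound.
module Submission where

open import Defs
open import Data.Nat using (ℕ; zero; suc; _+_; _*_; _∸_; _≤_; _<_; _≡ᵇ_; _<ᵇ_; z≤n; s≤s)
open import Data.Nat.Properties
open import Data.Nat.Tactic.RingSolver using (solve-∀)
open import Algebra.Properties.CommutativeSemigroup +-commutativeSemigroup using (interchange)
open import Data.Bool using (Bool; T; true; false; if_then_else_; _∨_)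
open import Data.Bool.Properties using (∨-assoc)
open import Function using (_∘_)
open import Relation.Nullary using (contradiction)
open import Relation.Nullary.Reflects using (ofʸ; ofⁿ)
open import Relation.Binary.PropositionalEquality

bit : Bool → ℕ
bit b = if b then 1 else 0

bit-∨ : ∀ b b′ → bit (b ∨ b′) ≤ bit b + bit b′
bit-∨ true  _ = s≤s z≤n
bit-∨ false _ = ≤-refl

m<n⇒bit[m<ᵇn]≡1 : ∀ {m n} → m < n → bit (m <ᵇ n) ≡ 1
m<n⇒bit[m<ᵇn]≡1 {m} {n} m<n with m <ᵇ n | <ᵇ-reflects-< m n
... | true  | _         = refl
... | false | ofⁿ m≮n = contradiction m<n m≮n

m≡n⇒bit[m<ᵇn]≡0 : ∀ {m n} → m ≡ n → bit (m <ᵇ n) ≡ 0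
m≡n⇒bit[m<ᵇn]≡0 {m} {n} m≡n with m <ᵇ n | <ᵇ-reflects-< m n
... | false | _         = refl
... | true  | ofʸ m<n = contradiction m≡n (<⇒≢ m<n)

countFrom-cong : ∀ {f g} → (∀ x → f x ≡ g x) → ∀ a k → countFrom f a k ≡ countFrom g a k
countFrom-cong     f≗g a zero    = refl
countFrom-cong {g = g} f≗g a (suc k) rewrite f≗g (a + suc k) =
  cong (bit (g (a + suc k)) +_) (countFrom-cong f≗g a k)

countFrom-∨ : ∀ f g a k → countFrom (λ x → f x ∨ g x) a k ≤ countFrom f a k + countFrom g a k
countFrom-∨ f g a zero    = z≤n
countFrom-∨ f g a (suc k) = begin
  bit (f x ∨ g x) + countFrom (λ x → f x ∨ g x) a k
    ≤⟨ +-mono-≤ (bit-∨ (f x) (g x)) (countFrom-∨ f g a k) ⟩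
  (bit (f x) + bit (g x)) + (countFrom f a k + countFrom g a k)
    ≡⟨ interchange (bit (f x)) (bit (g x)) (countFrom f a k) (countFrom g a k) ⟩
  (bit (f x) + countFrom f a k) + (bit (g x) + countFrom g a k) ∎
  where
  open ≤-Reasoning
  x = a + suc k

countFrom-≡ᵇ-below : ∀ y a k → a + k < y → countFrom (_≡ᵇ y) a k ≡ 0
countFrom-≡ᵇ-below y a zero    _       = refl
countFrom-≡ᵇ-below y a (suc k) a+1+k<y
  with a + suc k ≡ᵇ y | ≡ᵇ⇒≡ (a + suc k) y
... | false | _ = countFrom-≡ᵇ-below y a k (≤-<-trans (+-monoʳ-≤ a (n≤1+n k)) a+1+k<y)
... | true  | x≡y = contradiction (x≡y _) (<⇒≢ a+1+k<y)

countFrom-≡ᵇ≤1 : ∀ y a k → countFrom (_≡ᵇ y) a k ≤ 1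
countFrom-≡ᵇ≤1 y a zero = z≤n
countFrom-≡ᵇ≤1 y a (suc k) with a + suc k ≡ᵇ y | ≡ᵇ⇒≡ (a + suc k) y
... | false | _   = countFrom-≡ᵇ≤1 y a k
... | true  | x≡y rewrite sym (x≡y _) =
  ≤-reflexive (cong suc (countFrom-≡ᵇ-below (a + suc k) a k (+-monoʳ-< a (n<1+n k))))

card-cong : ∀ n {S′ S} → SameSet S′ S → card n S′ ≡ card n S
card-cong n S′≗S = countFrom-cong S′≗S 0 n

card-AddOne : ∀ n {S′ S y} → AddOne S′ S y → card n S′ ≤ 1 + card n S
card-AddOne n {S′} {S} {y} S′≗S∪y = begin
  card n S′                                ≡⟨ card-cong n S′≗S∪y ⟩
  countFrom (λ x → S x ∨ (x ≡ᵇ y)) 0 n     ≤⟨ countFrom-∨ S (_≡ᵇ y) 0 n ⟩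
  card n S + countFrom (_≡ᵇ y) 0 n         ≤⟨ +-monoʳ-≤ (card n S) (countFrom-≡ᵇ≤1 y 0 n) ⟩
  card n S + 1                             ≡⟨ +-comm (card n S) 1 ⟩
  1 + card n S                             ∎
  where open ≤-Reasoning

card-AddTwo : ∀ n {S′ S y z} → AddTwo S′ S y z → card n S′ ≤ 2 + card n S
card-AddTwo n {S′} {S} {y} {z} S′≗S∪yz = begin
  card n S′                             ≤⟨ card-AddOne n (λ x → trans (S′≗S∪yz x) (sym (∨-assoc (S x) _ _))) ⟩
  1 + card n (λ x → S x ∨ (x ≡ᵇ y))     ≤⟨ s≤s (card-AddOne n (λ _ → refl)) ⟩
  2 + card n S                          ∎
  where open ≤-Reasoning

sumFrom : (ℕ → ℕ) → ℕ → ℕ → ℕ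
sumFrom w a zero    = 0
sumFrom w a (suc k) = w (a + suc k) + sumFrom w a k

sumFrom-telescope : ∀ (Φ w : ℕ → ℕ) {a b} → a ≤ b →
  (∀ i → a ≤ i → i < b → Φ (suc i) ≤ w (suc i) + Φ i) →
  Φ b ≤ sumFrom w a (b ∸ a) + Φ a
sumFrom-telescope Φ w {a} {b} a≤b step =
  subst (λ m → Φ m ≤ sumFrom w a (b ∸ a) + Φ a) (m+[n∸m]≡n a≤b)
        (partial (b ∸ a) (≤-reflexive (m+[n∸m]≡n a≤b)))
  where
  partial : ∀ k → a + k ≤ b → Φ (a + k) ≤ sumFrom w a k + Φ a
  partial zero    _ = ≤-reflexive (cong Φ (+-identityʳ a))
  partial (suc k) a+1+k≤b rewrite +-suc a k = begin
    Φ (suc (a + k))                              ≤⟨ step (a + k) (m≤m+n a k) a+1+k≤b ⟩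
    w (suc (a + k)) + Φ (a + k)                  ≤⟨ +-monoʳ-≤ _ (partial k (≤-trans (n≤1+n _) a+1+k≤b)) ⟩
    w (suc (a + k)) + (sumFrom w a k + Φ a)      ≡⟨ +-assoc (w (suc (a + k))) (sumFrom w a k) (Φ a) ⟨
    w (suc (a + k)) + sumFrom w a k + Φ a        ∎
    where open ≤-Reasoning

sumFrom-weighted-bits : ∀ (f g h : ℕ → Bool) a k →
  sumFrom (λ j → bit (f j) + 2 * bit (g j) + 4 * bit (h j)) a k
    ≡ countFrom f a k + 2 * countFrom g a k + 4 * countFrom h a k
sumFrom-weighted-bits f g h a zero    = refl
sumFrom-weighted-bits f g h a (suc k) =
  trans (cong (bit (f j) + 2 * bit (g j) + 4 * bit (h j) +_) (sumFrom-weighted-bits f g h a k))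
        (regroup (bit (f j)) (bit (g j)) (bit (h j)) (countFrom f a k) (countFrom g a k) (countFrom h a k))
  where
  j = a + suc k
  regroup : ∀ x y z X Y Z →
    (x + 2 * y + 4 * z) + (X + 2 * Y + 4 * Z) ≡ (x + X) + 2 * (y + Y) + 4 * (z + Z)
  regroup = solve-∀

weight : Case → ℕ
weight L = bit (isBC L) + 2 * bit (isBUc L) + 4 * bit (isBUd L)

potential : ℕ → (ℕ → ℕ → Bool) → (ℕ → ℕ) → ℕ → ℕ
potential n S ptr i = 2 * card n (S i) + bit (ptr i <ᵇ i)

potential-bound : ∀ k w {s s′ b b′} → s′ ≤ k + s → 2 * k + b′ ≤ w + b → 2 * s′ + b′ ≤ w + (2 * s + b)
potential-bound k w {s} {s′} {b} {b′} s′≤k+s 2k+b′≤w+b = begin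
  2 * s′ + b′            ≤⟨ +-monoˡ-≤ b′ (*-monoʳ-≤ 2 s′≤k+s) ⟩
  2 * (k + s) + b′       ≡⟨ regroup k s b′ ⟩
  (2 * k + b′) + 2 * s   ≤⟨ +-monoˡ-≤ (2 * s) 2k+b′≤w+b ⟩
  (w + b) + 2 * s        ≡⟨ regroup′ w b s ⟩
  w + (2 * s + b)        ∎
  where
  open ≤-Reasoning
  regroup : ∀ k s b′ → 2 * (k + s) + b′ ≡ (2 * k + b′) + 2 * s
  regroup = solve-∀
  regroup′ : ∀ w b s → (w + b) + 2 * s ≡ w + (2 * s + b)
  regroup′ = solve-∀

potential-step : ∀ n {p c S ptr i L} → Step p c S ptr i L →
  potential n S ptr (suc i) ≤ weight L + potential n S ptr i
potential-step n (stepA1 ptr≡i _ _ _ same ptr′≡1+i)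
  rewrite m≡n⇒bit[m<ᵇn]≡0 ptr≡i | m≡n⇒bit[m<ᵇn]≡0 ptr′≡1+i =
  potential-bound 0 0 (≤-reflexive (card-cong n same)) ≤-refl
potential-step n (stepA2 ptr≡i _ _ same ptr′≡i)
  rewrite m≡n⇒bit[m<ᵇn]≡0 ptr≡i | m<n⇒bit[m<ᵇn]≡1 (≤-reflexive (cong suc ptr′≡i)) =
  potential-bound 0 1 (≤-reflexive (card-cong n same)) ≤-refl
potential-step n {i = i} (stepB1 ptr<i _ _ _ same ptr′≡ptr)
  rewrite m<n⇒bit[m<ᵇn]≡1 ptr<i
        | m<n⇒bit[m<ᵇn]≡1 (subst (_< suc i) (sym ptr′≡ptr) (m<n⇒m<1+n ptr<i)) =
  potential-bound 0 0 (≤-reflexive (card-cong n same)) ≤-refl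
potential-step n (stepB2a ptr<i _ _ add ptr′≡1+i)
  rewrite m<n⇒bit[m<ᵇn]≡1 ptr<i | m≡n⇒bit[m<ᵇn]≡0 ptr′≡1+i =
  potential-bound 1 1 (card-AddOne n add) ≤-refl
potential-step n (stepB2b ptr<i _ _ _ add ptr′≡1+i)
  rewrite m<n⇒bit[m<ᵇn]≡1 ptr<i | m≡n⇒bit[m<ᵇn]≡0 ptr′≡1+i =
  potential-bound 1 1 (card-AddOne n add) ≤-refl
potential-step n (stepB2c ptr<i _ _ _ _ add ptr′≡1+i)
  rewrite m<n⇒bit[m<ᵇn]≡1 ptr<i | m≡n⇒bit[m<ᵇn]≡0 ptr′≡1+i =
  potential-bound 1 2 (card-AddOne n add) (n≤1+n 2)
potential-step n (stepB2d ptr<i _ _ _ _ add ptr′≡1+i)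
  rewrite m<n⇒bit[m<ᵇn]≡1 ptr<i | m≡n⇒bit[m<ᵇn]≡0 ptr′≡1+i =
  potential-bound 2 4 (card-AddTwo n add) (n≤1+n 4)

lemma2p2 : (n : ℕ) (p : ℕ → ℕ) → IsPerfectMatching n p →
    (i₀ i₁ : ℕ) → 1 ≤ i₀ → i₀ ≤ i₁ → i₁ ≤ n ∸ 1 →
    (c₀ : ℕ → Colour) → ProperOn n p i₀ c₀ →
    (S₀ : ℕ → Bool) → (∀ x → T (S₀ x) → InRange i₀ x) →
    (c : ℕ → Colour) (S : ℕ → ℕ → Bool) (ptr : ℕ → ℕ) (lab : ℕ → Case) →
    (∀ v → InRange i₀ v → c v ≡ c₀ v) →
    SameSet (S i₀) S₀ → ptr i₀ ≡ i₀ →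
    (∀ i → i₀ ≤ i → i < i₁ → Step p c S ptr i (lab (suc i))) →
    2 * card n (S i₁)
      ≤ countFrom (λ j → isBC (lab j)) i₀ (i₁ ∸ i₀)
        + 2 * countFrom (λ j → isBUc (lab j)) i₀ (i₁ ∸ i₀)
        + 4 * countFrom (λ j → isBUd (lab j)) i₀ (i₁ ∸ i₀)
        + 2 * card n S₀
lemma2p2 n p _ i₀ i₁ _ i₀≤i₁ _ _ _ S₀ _ c S ptr lab _ S[i₀]≗S₀ ptr[i₀]≡i₀ steps = begin
  2 * card n (S i₁)
    ≤⟨ m≤m+n _ _ ⟩
  potential n S ptr i₁
    ≤⟨ sumFrom-telescope (potential n S ptr) (weight ∘ lab) i₀≤i₁
         (λ i i₀≤i i<i₁ → potential-step n (steps i i₀≤i i<i₁)) ⟩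
  sumFrom (weight ∘ lab) i₀ (i₁ ∸ i₀) + potential n S ptr i₀
    ≡⟨ cong₂ _+_ (sumFrom-weighted-bits (isBC ∘ lab) (isBUc ∘ lab) (isBUd ∘ lab) i₀ (i₁ ∸ i₀))
                 initial-potential ⟩
  _ ∎
  where
  open ≤-Reasoning
  initial-potential : potential n S ptr i₀ ≡ 2 * card n S₀
  initial-potential = begin-equality
    2 * card n (S i₀) + bit (ptr i₀ <ᵇ i₀)  ≡⟨ cong₂ _+_ (cong (2 *_) (card-cong n S[i₀]≗S₀))
                                                        (m≡n⇒bit[m<ᵇn]≡0 ptr[i₀]≡i₀) ⟩
    2 * card n S₀ + 0                      ≡⟨ +-identityʳ _ ⟩
    2 * card n S₀                          ∎
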